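{- Define four families of polynomials $f^{(i)}(X), t^{(i)}(X), d^{(i)}(X), s^{(i)}(X)$ ($i \ge 0$) by the simultaneous recursions $$f^{(0)}(X)=1;\qquad t^{(i)}(X)=\sum_{j=0}^{i}\binom{i}{j}X^{i-j}f^{(j)}(X)\ (i\ge 0);\qquad d^{(i)}(X)=t^{(i)}(X)-X\,f^{(i)}(X)\ (i\ge 0);$$ $$s^{(i)}(X)=f^{(i)}(X)+d^{(i)}(X)\ (i\ge 0);\qquad f^{(i)}(X)=\sum_{j=0}^{i-1}\binom{i}{j}X^{i-1-j}s^{(j)}(X)\ (i\ge 1).$$ Then for every $i\ge 1$, $$f^{(i)}(X)=\sum_{j=0}^{i}\binom{i}{j}X^{i-j}d^{(j)}(X).$$ -}

module Defs where

open import Level using (Level)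
open import Algebra.Bundles using (CommutativeRing; Semiring)
open import Data.Nat using (ℕ; zero; suc; _∸_)
open import Data.Nat.Combinatorics using (_C_)
import Algebra.Definitions.RawSemiring as RS

module _ {c ℓ : Level} (R : CommutativeRing c ℓ) where
  open CommutativeRing R
  open RS (Semiring.rawSemiring semiring) using (_×_; _^_)

  ΣBelow : ℕ → (ℕ → Carrier) → Carrier
  ΣBelow zero    g = 0#
  ΣBelow (suc n) g = ΣBelow n g + g n

  binSum : ℕ → ℕ → ℕ → Carrier → (ℕ → Carrier) → Carrier
  binSum m i e x a = ΣBelow m (λ j → (i C j) × ((x ^ (e ∸ j)) * a j))

-- Write n = i + 1. Since d + f = s, the sums Σ_{j<n} C(n,j) X^(n-j) d^(j) and
-- Σ_{j<n} C(n,j) X^(n-j) f^(j) add up to X · Σ_{j<n} C(n,j) X^(n-1-j) s^(j) = X f^(n).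
-- The remaining term of the sum for f^(n) is d^(n) = t^(n) - X f^(n), and t^(n) is the
-- second of those sums plus f^(n), so the whole sum collapses to f^(n).
module Submission where

open import Defs
open import Level using (Level)
open import Algebra.Bundles using (CommutativeRing; Semiring)
open import Data.Nat using (ℕ; suc; zero; _≤_; _<_; _∸_)
open import Data.Nat.Properties using (m<n⇒m<1+n; ≤-refl; +-∸-assoc; <-≤-trans; m<1+n⇒m≤n; n∸n≡0)
open import Data.Nat.Combinatorics using (_C_; nCn≡1)
import Algebra.Definitions.RawSemiring as RawSemiring
import Algebra.Properties.Semiring.Mult as SemiringMult
import Algebra.Properties.CommutativeMonoid.Mult as CommutativeMonoidMult
import Algebra.Properties.CommutativeSemigroup as CommutativeSemigroupProperties
import Algebra.Properties.AbelianGroup as AbelianGroupProperties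
import Relation.Binary.Reasoning.Setoid as SetoidReasoning

module BinomialSums {c ℓ : Level} (R : CommutativeRing c ℓ) where
  open CommutativeRing R
  open RawSemiring (Semiring.rawSemiring semiring) using (_×_; _^_)
  open SemiringMult semiring using (×-comm-*; ×-congʳ; ×-homo-1)
  open CommutativeMonoidMult +-commutativeMonoid using (×-distrib-+)
  open CommutativeSemigroupProperties +-commutativeSemigroup using (interchange)
  open AbelianGroupProperties +-abelianGroup using (xyx⁻¹≈y)
  open SetoidReasoning setoid

  ΣBelow-cong : ∀ n {g h : ℕ → Carrier} → (∀ j → j < n → g j ≈ h j) →
                ΣBelow R n g ≈ ΣBelow R n h
  ΣBelow-cong zero    g≈h = refl
  ΣBelow-cong (suc n) g≈h =
    +-cong (ΣBelow-cong n (λ j j<n → g≈h j (m<n⇒m<1+n j<n))) (g≈h n ≤-refl)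

  ΣBelow-+ : ∀ n (g h : ℕ → Carrier) →
             ΣBelow R n g + ΣBelow R n h ≈ ΣBelow R n (λ j → g j + h j)
  ΣBelow-+ zero    g h = +-identityˡ 0#
  ΣBelow-+ (suc n) g h = trans (interchange _ _ _ _) (+-congʳ (ΣBelow-+ n g h))

  ΣBelow-*ˡ : ∀ n x (g : ℕ → Carrier) → x * ΣBelow R n g ≈ ΣBelow R n (λ j → x * g j)
  ΣBelow-*ˡ zero    x g = zeroʳ x
  ΣBelow-*ˡ (suc n) x g = trans (distribˡ x _ _) (+-congʳ (ΣBelow-*ˡ n x g))

  binSum-cong : ∀ m i e x {a b : ℕ → Carrier} → (∀ j → a j ≈ b j) →
                binSum R m i e x a ≈ binSum R m i e x b
  binSum-cong m i e x a≈b = ΣBelow-cong m (λ j _ → ×-congʳ (i C j) (*-congˡ (a≈b j)))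

  binSum-+ : ∀ m i e x (a b : ℕ → Carrier) →
             binSum R m i e x a + binSum R m i e x b ≈ binSum R m i e x (λ j → a j + b j)
  binSum-+ m i e x a b = trans (ΣBelow-+ m _ _) (ΣBelow-cong m (λ j _ → begin
    (i C j) × (x ^ (e ∸ j) * a j) + (i C j) × (x ^ (e ∸ j) * b j)
      ≈⟨ ×-distrib-+ _ _ (i C j) ⟨
    (i C j) × (x ^ (e ∸ j) * a j + x ^ (e ∸ j) * b j)
      ≈⟨ ×-congʳ (i C j) (distribˡ _ _ _) ⟨
    (i C j) × (x ^ (e ∸ j) * (a j + b j)) ∎))

  binSum-suc-exponent : ∀ m i e x (a : ℕ → Carrier) → m ≤ suc e →
                        binSum R m i (suc e) x a ≈ x * binSum R m i e x a
  binSum-suc-exponent m i e x a m≤1+e = sym (trans (ΣBelow-*ˡ m x _) (ΣBelow-cong m term))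
    where
    term : ∀ j → j < m → x * ((i C j) × (x ^ (e ∸ j) * a j)) ≈ (i C j) × (x ^ (suc e ∸ j) * a j)
    term j j<m rewrite +-∸-assoc 1 (m<1+n⇒m≤n (<-≤-trans j<m m≤1+e)) = begin
      x * ((i C j) × (x ^ (e ∸ j) * a j)) ≈⟨ ×-comm-* (i C j) x _ ⟩
      (i C j) × (x * (x ^ (e ∸ j) * a j)) ≈⟨ ×-congʳ (i C j) (*-assoc x _ _) ⟨
      (i C j) × (x ^ suc (e ∸ j) * a j)   ∎

  binSum-diagonal : ∀ n x (a : ℕ → Carrier) →
                    binSum R (suc n) n n x a ≈ binSum R n n n x a + a n
  binSum-diagonal n x a rewrite nCn≡1 n | n∸n≡0 n =
    +-congˡ (trans (×-homo-1 _) (*-identityˡ (a n)))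

  x+y≈z⇒x+[y+w-z]≈w : ∀ {x y z} w → x + y ≈ z → x + ((y + w) - z) ≈ w
  x+y≈z⇒x+[y+w-z]≈w {x} {y} {z} w x+y≈z = begin
    x + ((y + w) - z) ≈⟨ +-assoc x (y + w) (- z) ⟨
    (x + (y + w)) - z ≈⟨ +-congʳ (+-assoc x y w) ⟨
    ((x + y) + w) - z ≈⟨ +-congʳ (+-congʳ x+y≈z) ⟩
    (z + w) - z       ≈⟨ xyx⁻¹≈y z w ⟩
    w                 ∎

mainTheorem2 : {c ℓ : Level} (R : CommutativeRing c ℓ) (X : CommutativeRing.Carrier R)
               (f t d s : ℕ → CommutativeRing.Carrier R) →
               CommutativeRing._≈_ R (f 0) (CommutativeRing.1# R) →
               (∀ i → CommutativeRing._≈_ R (t i) (binSum R (suc i) i i X f)) →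
               (∀ i → CommutativeRing._≈_ R (d i) (CommutativeRing._-_ R (t i) (CommutativeRing._*_ R X (f i)))) →
               (∀ i → CommutativeRing._≈_ R (s i) (CommutativeRing._+_ R (f i) (d i))) →
               (∀ i → CommutativeRing._≈_ R (f (suc i)) (binSum R (suc i) (suc i) i X s)) →
               ∀ i → CommutativeRing._≈_ R (f (suc i)) (binSum R (suc (suc i)) (suc i) (suc i) X d)
mainTheorem2 R X f t d s _ t≈ d≈ s≈ f≈ i = sym (begin
  binSum R (suc n) n n X d               ≈⟨ binSum-diagonal n X d ⟩
  B d + d n                              ≈⟨ +-congˡ (d≈ n) ⟩
  B d + (t n - X * f n)                  ≈⟨ +-congˡ (+-congʳ (trans (t≈ n) (binSum-diagonal n X f))) ⟩
  B d + ((B f + f n) - X * f n)          ≈⟨ x+y≈z⇒x+[y+w-z]≈w (f n) Bd+Bf≈Xf ⟩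
  f n                                    ∎)
  where
  open CommutativeRing R
  open BinomialSums R
  open SetoidReasoning setoid
  n = suc i
  B : (ℕ → Carrier) → Carrier
  B = binSum R n n n X
  Bd+Bf≈Xf : B d + B f ≈ X * f n
  Bd+Bf≈Xf = begin
    B d + B f                       ≈⟨ binSum-+ n n n X d f ⟩
    B (λ j → d j + f j)             ≈⟨ binSum-cong n n n X (λ j → trans (+-comm (d j) (f j)) (sym (s≈ j))) ⟩
    B s                             ≈⟨ binSum-suc-exponent n n i X s ≤-refl ⟩
    X * binSum R n n i X s          ≈⟨ *-congˡ (f≈ i) ⟨
    X * f n                         ∎
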